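{- Let $G,H$ be finite, non-redundant, robustly rooted graphs and let $S_G$, $S_H$ be roots of $G$ and $H$ respectively. If the unfolding trees $\mathcal{T}(G,S_G)$ and $\mathcal{T}(H,S_H)$ are almost isomorphic, then $G$ and $H$ are isomorphic.
   Context: A graph is $G=(V,E,o,t)$ with vertex set $V$, edge set $E$, maps $o,t:E\to V$ (origin, terminus); loops and multiple edges allowed; finite means $V,E$ finite. Isomorphisms are pairs of bijections on vertices and edges compatible with $o,t$. $E_o(v)=\{e:o(e)=v\}$, $E_t(v)=\{e:t(e)=v\}$, $N_o(v)=t[E_o(v)]$. A walk is an empty walk $\epsilon_v$ ($O=T=v$) or $e_1\dots e_n$ with $t(e_i)=o(e_{i+1})$, $O=o(e_1)$, $T=t(e_n)$. A root is a vertex from which every vertex is reachable by a walk. For a vertex $x$, $G_x$ is the vertex-induced subgraph on the vertices reachable from $x$. A graph with a root is robustly rooted if for each vertex $v$ with $G_v=G$ there exists $w\in N_o(v)$ with $G_w=G$. An equivalence relation on $G$ is a pair of equivalence relations $\sim_V$, $\sim_E$ on $V$, $E$ with $e_1\sim_E e_2\Rightarrow o(e_1)\sim_V o(e_2), t(e_1)\sim_V t(e_2)$; it is non-edge-collapsing if for all $v\sim_V v'$ and every edge $e$ with $o(e)=v$ there is exactly one edge $e'$ with $o(e')=v'$ and $e\sim_E e'$; $G$ is non-redundant if its only non-edge-collapsing equivalence relation is the trivial one (both components equality). The unfolding tree $\mathcal{T}(G,S)$ has vertices the walks with origin $S$ and an edge from $w$ to $we$ whenever $e$ is an edge and $we$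 a walk. A tree is a graph in which any two vertices are termini of walks with a common origin, with no nonempty closed walks, and in which distinct edges have distinct termini. For a graph $G$ and subgraph $H$, $G\setminus H$ has edges $EG\setminus EH$ and vertices $VG$ minus those $v$ with $E_o(v),E_t(v)\neq\emptyset$ and $E_o(v)\cup E_t(v)\subseteq EH$. Trees $\mathcal{T}_1,\mathcal{T}_2$ are almost isomorphic if there exist finite subtrees $T_i\le\mathcal{T}_i$ and an isomorphism $\mathcal{T}_1\setminus T_1\to\mathcal{T}_2\setminus T_2$. -}

module Defs where

open import Level using (Level)
open import Data.Nat using (ℕ)
open import Data.Fin using (Fin)
open import Data.Product using (Σ; ∃; _×_; _,_; proj₁; proj₂)
open import Data.Empty using (⊥)
open import Relation.Nullary using (¬_)
open import Relation.Binary using (IsEquivalence)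
open import Relation.Binary.PropositionalEquality using (_≡_; refl)
open import Function.Bundles using (_↔_; Inverse)
open import Data.Irrelevant using ([_])
open import Data.Refinement using (Refinement; _,_; value; proof)

record Graph : Set₁ where
  field
    V : Set
    E : Set
    o : E → V
    t : E → V
open Graph public

Finite : Set → Set
Finite A = Σ ℕ λ n → A ↔ Fin n

FiniteGraph : Graph → Set
FiniteGraph G = Finite (V G) × Finite (E G)

record Iso (G H : Graph) : Set where
  field
    isoV : V G ↔ V H
    isoE : E G ↔ E H
    o-compat : ∀ e → o H (Inverse.to isoE e) ≡ Inverse.to isoV (o G e)
    t-compat : ∀ e → t H (Inverse.to isoE e) ≡ Inverse.to isoV (t G e)

data Walk (G : Graph) : V G → V G → Set where
  ε   : ∀ {x} → Walk G x x
  _∷_ : ∀ {y} (e : E G) → Walk G (t G e) y → Walk G (o G e) y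

infixr 5 _∷_

snoc : ∀ {G : Graph} {x} (e : E G) → Walk G x (o G e) → Walk G x (t G e)
snoc e ε        = e ∷ ε
snoc e (e′ ∷ w) = e′ ∷ snoc e w

IsRoot : (G : Graph) → V G → Set
IsRoot G S = ∀ v → Walk G S v

HasRoot : Graph → Set
HasRoot G = ∃ λ S → IsRoot G S

record Subgraph (G : Graph) : Set₁ where
  field
    PV : V G → Set
    PE : E G → Set
    o-closed : ∀ e → PE e → PV (o G e)
    t-closed : ∀ e → PE e → PV (t G e)
open Subgraph public

asGraph : ∀ {G} → Subgraph G → Graph
asGraph {G} H = record
  { V = Refinement (V G) (PV H)
  ; E = Refinement (E G) (PE H)
  ; o = λ { (e , [ p ]) → o G e , [ o-closed H e p ] }
  ; t = λ { (e , [ p ]) → t G e , [ t-closed H e p ] }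
  }

IsWhole : ∀ {G} → Subgraph G → Set
IsWhole {G} H = (∀ v → PV H v) × (∀ e → PE H e)

Reach : (G : Graph) → V G → Subgraph G
Reach G x = record
  { PV = λ v → Walk G x v
  ; PE = λ e → Walk G x (o G e) × Walk G x (t G e)
  ; o-closed = λ e p → proj₁ p
  ; t-closed = λ e p → proj₂ p
  }

RobustlyRooted : Graph → Set
RobustlyRooted G =
  HasRoot G ×
  (∀ v → IsWhole (Reach G v) →
     ∃ λ (e : E G) → o G e ≡ v × IsWhole (Reach G (t G e)))

record GraphEquiv (G : Graph) : Set₁ where
  field
    _~V_ : V G → V G → Set
    _~E_ : E G → E G → Set
    isEquivV : IsEquivalence _~V_
    isEquivE : IsEquivalence _~E_
    o-resp : ∀ {e₁ e₂} → e₁ ~E e₂ → o G e₁ ~V o G e₂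
    t-resp : ∀ {e₁ e₂} → e₁ ~E e₂ → t G e₁ ~V t G e₂
open GraphEquiv public

NonEdgeCollapsing : ∀ {G} → GraphEquiv G → Set
NonEdgeCollapsing {G} R =
  ∀ v v′ → _~V_ R v v′ → ∀ (e : E G) → o G e ≡ v →
    Σ (E G) λ e′ → (o G e′ ≡ v′ × _~E_ R e e′) ×
      (∀ e″ → o G e″ ≡ v′ → _~E_ R e e″ → e″ ≡ e′)

Trivial : ∀ {G} → GraphEquiv G → Set
Trivial {G} R = (∀ v v′ → _~V_ R v v′ → v ≡ v′) × (∀ e e′ → _~E_ R e e′ → e ≡ e′)

NonRedundant : Graph → Set₁
NonRedundant G = ∀ (R : GraphEquiv G) → NonEdgeCollapsing R → Trivial R

-- Unfolding tree T(G,S): vertices are the walks with origin S;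
-- one edge w → w e for each edge e with w e a walk
-- (an edge is represented by the pair (e , w) with T(w) = o(e)).

Unfolding : (G : Graph) → V G → Graph
Unfolding G S = record
  { V = Σ (V G) λ v → Walk G S v
  ; E = Σ (E G) λ e → Walk G S (o G e)
  ; o = λ { (e , w) → o G e , w }
  ; t = λ { (e , w) → t G e , snoc e w }
  }

IsTree : Graph → Set
IsTree G =
  (∀ x y → ∃ λ z → Walk G z x × Walk G z y) ×
  (∀ (e : E G) → Walk G (t G e) (o G e) → ⊥) ×
  (∀ e₁ e₂ → t G e₁ ≡ t G e₂ → e₁ ≡ e₂)

Removed : ∀ {G} → Subgraph G → V G → Set
Removed {G} H v =
  (∃ λ e → o G e ≡ v) × (∃ λ e → t G e ≡ v) ×
  (∀ e → o G e ≡ v → PE H e) × (∀ e → t G e ≡ v → PE H e)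

_∖_ : (G : Graph) → Subgraph G → Graph
G ∖ H = record
  { V = Refinement (V G) λ v → ¬ Removed H v
  ; E = Refinement (E G) λ e → ¬ PE H e
  ; o = λ { (e , [ p ]) → o G e , [ (λ r → p (proj₁ (proj₂ (proj₂ r)) e refl)) ] }
  ; t = λ { (e , [ p ]) → t G e , [ (λ r → p (proj₂ (proj₂ (proj₂ r)) e refl)) ] }
  }

FiniteSubtree : (G : Graph) → Subgraph G → Set
FiniteSubtree G T = FiniteGraph (asGraph T) × IsTree (asGraph T)

AlmostIsomorphic : Graph → Graph → Set₁
AlmostIsomorphic T₁ T₂ =
  Σ (Subgraph T₁) λ S₁ → Σ (Subgraph T₂) λ S₂ →
    FiniteSubtree T₁ S₁ × FiniteSubtree T₂ S₂ × Iso (T₁ ∖ S₁) (T₂ ∖ S₂)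

-- Cutting finite subtrees out of an unfolding only affects walks of bounded length, so beyond
-- some depth the almost-isomorphism is an honest isomorphism of unfoldings; composed with the
-- covering maps 𝒯(G,S_G) → G and 𝒯(H,S_H) → H it becomes a bisimulation between G and H.
-- Robust rootedness lets every vertex of G be reached by walks that are deep on both sides, so
-- this bisimulation is total, and symmetrically so is one from H to G. In a finite non-redundant
-- graph bisimilar vertices coincide: otherwise bisimilarity, with each edge identified with its
-- match at a fixed representative of the class of its origin, would be a non-trivial
-- non-edge-collapsing equivalence. Hence the two bisimulations are mutually inverse bijections,
-- and their edge matchings assemble into an isomorphism. The last argument is classical, but its
-- conclusion is an equality of vertices of a finite graph, which is decidable, so it can be run
-- in the double-negation monad.

module Submission where

open import Defs
open import Data.Bool.Base using (Bool; T)
open import Data.Empty using (⊥-elim)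
open import Data.Fin.Base as Fin using (Fin)
open import Data.Fin.Properties using (any?; sequence; ∀-cons) renaming (_≟_ to _≟ᶠ_)
open import Data.Irrelevant using ([_])
open import Data.Nat.Base using (ℕ; zero; suc; _+_; _≤_; _<_; _⊔_; z≤n; s≤s)
open import Data.Nat.Properties
  using (≤-refl; ≤-trans; n≤1+n; +-suc; m≤m+n; m≤n+m; m≤m⊔n; m≤n⊔m; <⇒≱; module ≤-Reasoning)
open import Data.Product.Base using (Σ; ∃; ∃₂; _×_; _,_; proj₁; proj₂)
open import Data.Product.Function.Dependent.Propositional using (Σ-↔)
open import Data.Refinement using (_,_; value)
open import Data.Refinement.Properties using (value-injective)
open import Data.Unit.Base using (⊤; tt)
open import Data.Vec.Base using (Vec; lookup; tabulate)
open import Data.Vec.Properties using (lookup∘tabulate; tabulate-cong)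
open import Effect.Monad using (RawMonad)
open import Function.Base using (_∘_; id; flip)
open import Function.Bundles using (_↔_; Inverse; mk↔ₛ′; mk⇔)
open import Function.Properties.Inverse using (↔-refl; ↔-sym; ↔-trans)
open import Relation.Binary.Definitions using (DecidableEquality)
open import Relation.Nullary.Decidable
  using ( Dec; yes; no; does; isYes; isYes≗does; does-⇔; ¬?; map′; T?; toWitness; fromWitness
        ; decidable-stable; ¬¬-excluded-middle )
open import Relation.Nullary.Negation
  using (¬_; DoubleNegation; ¬¬-Monad; ∀⟶¬∃¬)
open import Relation.Binary.PropositionalEquality
  using (_≡_; refl; sym; trans; cong; subst; module ≡-Reasoning)

open Inverse using (to; from; strictlyInverseˡ; strictlyInverseʳ)

module _ {A : Set} (finite : Finite A) where
  private
    enum = proj₂ finite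

  ∀-finite : {P : A → Set} → (∀ i → P (from enum i)) → ∀ a → P a
  ∀-finite {P} p a = subst P (strictlyInverseʳ enum a) (p (to enum a))

  finite-≟ : DecidableEquality A
  finite-≟ x y = map′ to-injective (cong (to enum)) (to enum x ≟ᶠ to enum y)
    where
    to-injective : to enum x ≡ to enum y → x ≡ y
    to-injective p = trans (sym (strictlyInverseʳ enum x))
                       (trans (cong (from enum) p) (strictlyInverseʳ enum y))

  ¬¬-∀ : {P : A → Set} → (∀ a → DoubleNegation (P a)) → DoubleNegation (∀ a → P a)
  ¬¬-∀ p = sequence (RawMonad.rawApplicative ¬¬-Monad) (p ∘ from enum) ∘ (_∘ ∀-finite)

Monotone : (ℕ → Set) → Set
Monotone Q = ∀ {j k} → j ≤ k → Q j → Q k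

uniform-bound-Fin : ∀ n (Q : Fin n → ℕ → Set) → (∀ i → Monotone (Q i)) →
                    (∀ i → ∃ (Q i)) → ∃ λ K → ∀ i → Q i K
uniform-bound-Fin zero    Q mono q = 0 , λ ()
uniform-bound-Fin (suc n) Q mono q =
  let K₀ , q₀ = q Fin.zero
      K  , qs = uniform-bound-Fin n (Q ∘ Fin.suc) (mono ∘ Fin.suc) (q ∘ Fin.suc)
  in  K₀ ⊔ K , ∀-cons (mono Fin.zero (m≤m⊔n K₀ K) q₀)
                      (λ i → mono (Fin.suc i) (m≤n⊔m K₀ K) (qs i))

uniform-bound : {A : Set} → Finite A → (Q : A → ℕ → Set) → (∀ a → Monotone (Q a)) →
                (∀ a → ∃ (Q a)) → ∃ λ K → ∀ a → Q a K
uniform-bound (n , enum) Q mono q =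
  let K , qs = uniform-bound-Fin n (Q ∘ from enum) (mono ∘ from enum) (q ∘ from enum)
  in  K , ∀-finite (n , enum) qs

-- Bisimulations

Out : (A : Graph) → V A → Set
Out A a = Σ (E A) λ e → o A e ≡ a

out-≡ : ∀ {A : Graph} {a} {x y : Out A a} → proj₁ x ≡ proj₁ y → x ≡ y
out-≡ {x = e , refl} {y = .e , refl} refl = refl

target : (A : Graph) {a : V A} → Out A a → V A
target A = t A ∘ proj₁

record Matching (A B : Graph) (R : V A → V B → Set) (a : V A) (b : V B) : Set where
  constructor _▸_
  field
    edges   : Out A a ↔ Out B b
    targets : ∀ x → R (target A x) (target B (to edges x))

module _ {A B : Graph} where

  matching-map : {R R′ : V A → V B → Set} → (∀ {a b} → R a b → R′ a b) →
                 ∀ {a b} → Matching A B R a b → Matching A B R′ a b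
  matching-map f (β ▸ r) = β ▸ (f ∘ r)

  matching-sym : {R : V A → V B → Set} {R′ : V B → V A → Set} → (∀ {a b} → R a b → R′ b a) →
                 ∀ {a b} → Matching A B R a b → Matching B A R′ b a
  matching-sym {R} f (β ▸ r) = ↔-sym β ▸ λ y →
    f (subst (R (target A (from β y)) ∘ target B) (strictlyInverseˡ β y) (r (from β y)))

  matching-trans : ∀ {C : Graph} {R : V A → V B → Set} {R′ : V B → V C → Set}
                     {R″ : V A → V C → Set} →
                   (∀ {a b c} → R a b → R′ b c → R″ a c) →
                   ∀ {a b c} → Matching A B R a b → Matching B C R′ b c → Matching A C R″ a c
  matching-trans f (β ▸ r) (γ ▸ r′) = ↔-trans β γ ▸ λ x → f (r x) (r′ (to β x))

Bisimilarₙ : ℕ → (A B : Graph) → V A → V B → Set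
Bisimilarₙ zero    A B a b = ⊤
Bisimilarₙ (suc k) A B a b = Matching A B (Bisimilarₙ k A B) a b

bisimilarₙ-refl : ∀ k {A : Graph} a → Bisimilarₙ k A A a a
bisimilarₙ-refl zero    a = tt
bisimilarₙ-refl (suc k) {A} a = ↔-refl ▸ λ x → bisimilarₙ-refl k (target A x)

bisimilarₙ-sym : ∀ k {A B : Graph} {a b} → Bisimilarₙ k A B a b → Bisimilarₙ k B A b a
bisimilarₙ-sym zero    _ = tt
bisimilarₙ-sym (suc k) m = matching-sym (bisimilarₙ-sym k) m

bisimilarₙ-trans : ∀ k {A B C : Graph} {a b c} →
                   Bisimilarₙ k A B a b → Bisimilarₙ k B C b c → Bisimilarₙ k A C a c
bisimilarₙ-trans zero    _ _ = tt
bisimilarₙ-trans (suc k) m m′ = matching-trans (bisimilarₙ-trans k) m m′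

bisimilarₙ-≤ : ∀ {j k} {A B : Graph} {a b} → j ≤ k → Bisimilarₙ k A B a b → Bisimilarₙ j A B a b
bisimilarₙ-≤ z≤n       _ = tt
bisimilarₙ-≤ (s≤s j≤k) m = matching-map (bisimilarₙ-≤ j≤k) m

record Bisimulation (A B : Graph) : Set₁ where
  field
    _∼_      : V A → V B → Set
    matching : ∀ {a b} → a ∼ b → Matching A B _∼_ a b

  bisimilarₙ : ∀ k {a b} → a ∼ b → Bisimilarₙ k A B a b
  bisimilarₙ zero    _ = tt
  bisimilarₙ (suc k) r = matching-map (bisimilarₙ k) (matching r)

open Bisimulation using (_∼_; matching; bisimilarₙ)

Total : ∀ {A B} → Bisimulation A B → Set
Total {A} C = ∀ (a : V A) → ∃ (_∼_ C a)

bisimulation-sym : ∀ {A B} → Bisimulation A B → Bisimulation B A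
bisimulation-sym C = record { _∼_ = flip (_∼_ C) ; matching = matching-sym id ∘ matching C }

bisimulation-∘ : ∀ {A B C} → Bisimulation A B → Bisimulation B C → Bisimulation A C
bisimulation-∘ C D = record
  { _∼_      = λ a c → ∃ λ b → _∼_ C a b × _∼_ D b c
  ; matching = λ { (_ , r , r′) →
      matching-trans (λ r r′ → _ , r , r′) (matching C r) (matching D r′) }
  }

-- Bisimilarity in finite non-redundant graphs

module _ {G : Graph} (finite : Finite (V G)) (nonRedundant : NonRedundant G) where
  private
    n    = proj₁ finite
    enum = proj₂ finite

  -- The ¬¬-stable form of ∀ k → Bisimilarₙ k G G a b, so that the argument can run in the
  -- double-negation monad.
  _≈_ : V G → V G → Set
  a ≈ b = ¬ ∃ λ k → ¬ Bisimilarₙ k G G a b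

  ≈-refl : ∀ {a} → a ≈ a
  ≈-refl (k , ¬a≈a) = ¬a≈a (bisimilarₙ-refl k _)

  ≈-sym : ∀ {a b} → a ≈ b → b ≈ a
  ≈-sym a≈b (k , ¬b≈a) = a≈b (k , ¬b≈a ∘ bisimilarₙ-sym k)

  ≈-trans : ∀ {a b c} → a ≈ b → b ≈ c → a ≈ c
  ≈-trans a≈b b≈c (k , ¬a≈c) =
    a≈b (k , λ ab → b≈c (k , λ bc → ¬a≈c (bisimilarₙ-trans k ab bc)))

  ≈⇒¬¬bisimilarₙ : ∀ k {a b} → a ≈ b → DoubleNegation (Bisimilarₙ k G G a b)
  ≈⇒¬¬bisimilarₙ k a≈b ¬ab = a≈b (k , ¬ab)

  module Classes (settled : ∀ a b → Dec (∃ λ k → ¬ Bisimilarₙ k G G a b)) where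

    _≈?_ : ∀ a b → Dec (a ≈ b)
    a ≈? b = ¬? (settled a b)

    stabilisation : ∃ λ K → ∀ a b → Bisimilarₙ K G G a b → a ≈ b
    stabilisation =
      uniform-bound finite (λ a K → ∀ b → Bisimilarₙ K G G a b → a ≈ b)
        (λ a j≤k q b → q b ∘ bisimilarₙ-≤ j≤k)
        (λ a → uniform-bound finite (λ b K → Bisimilarₙ K G G a b → a ≈ b)
                 (λ b j≤k q → q ∘ bisimilarₙ-≤ j≤k) (bound a))
      where
      bound : ∀ a b → ∃ λ K → Bisimilarₙ K G G a b → a ≈ b
      bound a b with settled a b
      ... | yes (k , ¬ab) = k , ⊥-elim ∘ ¬ab
      ... | no a≈b        = 0 , λ _ → a≈b

    K : ℕ
    K = proj₁ stabilisation

    -- Choosing the representative from the class as a vector of booleans, rather than from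
    -- the relation, is what makes it respect ≈ without function extensionality.
    classOf : V G → Vec Bool n
    classOf a = tabulate λ i → isYes (from enum i ≈? a)

    choose : Vec Bool n → V G → V G
    choose v default with any? (T? ∘ lookup v)
    ... | yes (i , _) = from enum i
    ... | no _        = default

    representative : V G → V G
    representative a = choose (classOf a) a

    representative-≈ : ∀ a → representative a ≈ a
    representative-≈ a with any? (T? ∘ lookup (classOf a))
    ... | yes (i , member) = toWitness (subst T (lookup∘tabulate _ i) member)
    ... | no _             = ≈-refl

    choose-default : ∀ v {a b} → ∃ (T ∘ lookup v) → choose v a ≡ choose v b
    choose-default v nonempty with any? (T? ∘ lookup v)
    ... | yes _     = refl
    ... | no  empty = ⊥-elim (empty nonempty)

    representative-resp : ∀ {a b} → a ≈ b → representative a ≡ representative b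
    representative-resp {a} {b} a≈b = trans (cong (λ v → choose v a) same-class)
                                            (choose-default (classOf b) (to enum b , b∈b))
      where
      same-class : classOf a ≡ classOf b
      same-class = tabulate-cong λ i → begin
        isYes (from enum i ≈? a) ≡⟨ isYes≗does _ ⟩
        does (from enum i ≈? a)  ≡⟨ does-⇔ (mk⇔ (λ c → ≈-trans c a≈b) (λ c → ≈-trans c (≈-sym a≈b)))
                                           (from enum i ≈? a) (from enum i ≈? b) ⟩
        does (from enum i ≈? b)  ≡⟨ isYes≗does _ ⟨
        isYes (from enum i ≈? b) ∎
        where open ≡-Reasoning
      b∈b : T (lookup (classOf b) (to enum b))
      b∈b = subst T (sym (lookup∘tabulate _ (to enum b)))
                    (fromWitness (subst (_≈ b) (sym (strictlyInverseʳ enum b)) ≈-refl))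

    module Collapse (toRepresentative : ∀ a → Bisimilarₙ (suc K) G G a (representative a)) where
      open Matching

      β : ∀ a → Out G a ↔ Out G (representative a)
      β a = edges (toRepresentative a)

      normalise : E G → E G
      normalise e = proj₁ (to (β (o G e)) (e , refl))

      normalise-out : ∀ {a} (x : Out G a) → normalise (proj₁ x) ≡ proj₁ (to (β a) x)
      normalise-out (e , refl) = refl

      o-normalise : ∀ e → o G (normalise e) ≡ representative (o G e)
      o-normalise e = proj₂ (to (β (o G e)) (e , refl))

      t-normalise : ∀ e → t G e ≈ t G (normalise e)
      t-normalise e = proj₂ stabilisation _ _ (targets (toRepresentative (o G e)) (e , refl))

      o-respects : ∀ {e e′} → normalise e ≡ normalise e′ → o G e ≈ o G e′
      o-respects {e} {e′} same = ≈-trans (≈-sym (representative-≈ (o G e)))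
        (subst (_≈ o G e′) (trans (sym (o-normalise e′)) (trans (cong (o G) (sym same)) (o-normalise e)))
               (representative-≈ (o G e′)))

      t-respects : ∀ {e e′} → normalise e ≡ normalise e′ → t G e ≈ t G e′
      t-respects {e} {e′} same = ≈-trans (t-normalise e)
        (subst (_≈ t G e′) (cong (t G) (sym same)) (≈-sym (t-normalise e′)))

      bisimilarity : GraphEquiv G
      bisimilarity = record
        { _~V_     = _≈_
        ; _~E_     = λ e e′ → normalise e ≡ normalise e′
        ; isEquivV = record { refl = ≈-refl ; sym = ≈-sym ; trans = ≈-trans }
        ; isEquivE = record { refl = refl ; sym = sym ; trans = trans }
        ; o-resp   = o-respects
        ; t-resp   = t-respects
        }

      bisimilarity-nonEdgeCollapsing : NonEdgeCollapsing bisimilarity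
      bisimilarity-nonEdgeCollapsing v v′ v≈v′ e refl =
        proj₁ x , (proj₂ x , sym normalise-x) , unique
        where
        image : Out G (representative v′)
        image = normalise e , trans (o-normalise e) (representative-resp v≈v′)

        x : Out G v′
        x = from (β v′) image

        normalise-x : normalise (proj₁ x) ≡ normalise e
        normalise-x = trans (normalise-out x) (cong proj₁ (strictlyInverseˡ (β v′) image))

        unique : ∀ e″ → o G e″ ≡ v′ → normalise e ≡ normalise e″ → e″ ≡ proj₁ x
        unique e″ o-e″ same = cong proj₁ (begin
          y                         ≡⟨ strictlyInverseʳ (β v′) y ⟨
          from (β v′) (to (β v′) y) ≡⟨ cong (from (β v′)) y↦image ⟩
          x                         ∎)
          where
          open ≡-Reasoning
          y : Out G v′
          y = e″ , o-e″
          y↦image : to (β v′) y ≡ image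
          y↦image = out-≡ {G} (trans (sym (normalise-out y)) (sym same))

      ≈⇒≡ : ∀ {a b} → a ≈ b → a ≡ b
      ≈⇒≡ = proj₁ (nonRedundant bisimilarity bisimilarity-nonEdgeCollapsing) _ _

  bisimilar⇒≡ : ∀ {x y} → (∀ k → Bisimilarₙ k G G x y) → x ≡ y
  bisimilar⇒≡ {x} {y} x∼y = decidable-stable (finite-≟ finite x y) do
    settled ← ¬¬-∀ finite λ a → ¬¬-∀ finite λ b → ¬¬-excluded-middle
    let open Classes settled
    toRepresentative ← ¬¬-∀ finite λ a → ≈⇒¬¬bisimilarₙ (suc K) (≈-sym (representative-≈ a))
    pure (Collapse.≈⇒≡ toRepresentative (∀⟶¬∃¬ x∼y))
    where open RawMonad ¬¬-Monad

-- Isomorphisms from total bisimulations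

edges↔Σ-out : (A : Graph) → E A ↔ Σ (V A) (Out A)
edges↔Σ-out A =
  mk↔ₛ′ (λ e → o A e , e , refl) (proj₁ ∘ proj₂) (λ { (_ , _ , refl) → refl }) (λ _ → refl)

module _ {A B : Graph} (finiteA : Finite (V A)) (nonRedundantA : NonRedundant A)
         (finiteB : Finite (V B)) (nonRedundantB : NonRedundant B)
         (C : Bisimulation A B) (totalC : Total C) (D : Bisimulation B A) (totalD : Total D) where
  private
    f : V A → V B
    f = proj₁ ∘ totalC

    g : V B → V A
    g = proj₁ ∘ totalD

    a∼fa : ∀ a k → Bisimilarₙ k A B a (f a)
    a∼fa a k = bisimilarₙ C k (proj₂ (totalC a))

    b∼gb : ∀ b k → Bisimilarₙ k B A b (g b)
    b∼gb b k = bisimilarₙ D k (proj₂ (totalD b))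

    gf : ∀ a → g (f a) ≡ a
    gf a = bisimilar⇒≡ finiteA nonRedundantA λ k →
      bisimilarₙ-sym k (bisimilarₙ-trans k (a∼fa a k) (b∼gb (f a) k))

    fg : ∀ b → f (g b) ≡ b
    fg b = bisimilar⇒≡ finiteB nonRedundantB λ k →
      bisimilarₙ-sym k (bisimilarₙ-trans k (b∼gb b k) (a∼fa (g b) k))

    vertices : V A ↔ V B
    vertices = mk↔ₛ′ f g fg gf

    out : ∀ a → Matching A B (_∼_ C) a (f a)
    out a = matching C (proj₂ (totalC a))

    edges : E A ↔ E B
    edges = ↔-trans (edges↔Σ-out A)
              (↔-trans (Σ-↔ vertices (Matching.edges (out _))) (↔-sym (edges↔Σ-out B)))

  total-bisimulations⇒Iso : Iso A B
  total-bisimulations⇒Iso = record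
    { isoV     = vertices
    ; isoE     = edges
    ; o-compat = λ e → proj₂ (to (Matching.edges (out (o A e))) (e , refl))
    ; t-compat = λ e → bisimilar⇒≡ finiteB nonRedundantB λ k →
        bisimilarₙ-trans k (bisimilarₙ-sym k (bisimilarₙ C k (Matching.targets (out (o A e)) (e , refl))))
                           (a∼fa (t A e) k)
    }

unfolding-bisimulation : (G : Graph) (S : V G) → Bisimulation (Unfolding G S) G
unfolding-bisimulation G S = record
  { _∼_      = λ q v → proj₁ q ≡ v
  ; matching = λ { {v , w} refl → out↔ w ▸ λ _ → refl }
  }
  where
  out↔ : ∀ {v} (w : Walk G S v) → Out (Unfolding G S) (v , w) ↔ Out G v
  out↔ w = mk↔ₛ′ (λ { ((e , _) , p) → e , cong proj₁ p })
                 (λ { (e , refl) → (e , w) , refl })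
                 (λ { (_ , refl) → refl })
                 (λ { (_ , refl) → refl })

module _ (T : Graph) (S : Subgraph T) (Good : V T → Set)
         (good-avoids : ∀ e → Good (o T e) → ¬ PE S e)
         (good-closed : ∀ e → Good (o T e) → Good (t T e)) where

  ∖-bisimulation : Bisimulation (T ∖ S) T
  ∖-bisimulation = record
    { _∼_      = λ x y → Good y × value x ≡ y
    ; matching = λ { (good , refl) → out↔ good ▸ λ { ((e , _) , refl) → good-closed e good , refl } }
    }
    where
    out↔ : ∀ {x} → Good (value x) → Out (T ∖ S) x ↔ Out T (value x)
    out↔ good = mk↔ₛ′ (λ { ((e , _) , p) → e , cong value p })
                      (λ { (e , p) → (e , [ good-avoids e (subst Good (sym p) good) ]) , value-injective p })
                      (λ _ → out-≡ {T} refl)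
                      (λ _ → out-≡ {T ∖ S} refl)

module _ {A B : Graph} (φ : Iso A B) where
  open Iso φ

  private
    from-compat : ∀ (end : (X : Graph) → E X → V X) →
                  (∀ e → end B (to isoE e) ≡ to isoV (end A e)) →
                  ∀ e → end A (from isoE e) ≡ from isoV (end B e)
    from-compat end compat e = begin
      end A (from isoE e)                       ≡⟨ strictlyInverseʳ isoV _ ⟨
      from isoV (to isoV (end A (from isoE e))) ≡⟨ cong (from isoV) (compat (from isoE e)) ⟨
      from isoV (end B (to isoE (from isoE e))) ≡⟨ cong (from isoV ∘ end B) (strictlyInverseˡ isoE e) ⟩
      from isoV (end B e)                       ∎
      where open ≡-Reasoning

  Iso-sym : Iso B A
  Iso-sym = record
    { isoV     = ↔-sym isoV
    ; isoE     = ↔-sym isoE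
    ; o-compat = from-compat o o-compat
    ; t-compat = from-compat t t-compat
    }

  Iso⇒bisimulation : Bisimulation A B
  Iso⇒bisimulation = record
    { _∼_      = λ a b → to isoV a ≡ b
    ; matching = λ { refl → out↔ ▸ λ { (e , _) → sym (t-compat e) } }
    }
    where
    out↔ : ∀ {a} → Out A a ↔ Out B (to isoV a)
    out↔ {a} = mk↔ₛ′ (λ { (e , p) → to isoE e , trans (o-compat e) (cong (to isoV) p) })
                     (λ { (e , p) → from isoE e , trans (Iso.o-compat Iso-sym e)
                                                      (trans (cong (from isoV) p) (strictlyInverseʳ isoV a)) })
                     (λ _ → out-≡ {B} (strictlyInverseˡ isoE _))
                     (λ _ → out-≡ {A} (strictlyInverseʳ isoE _))

-- Walks and depth in unfoldings

length : ∀ {G : Graph} {x y} → Walk G x y → ℕ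
length ε       = 0
length (_ ∷ w) = suc (length w)

length-snoc : ∀ {G : Graph} {x} (e : E G) (w : Walk G x (o G e)) →
              length (snoc e w) ≡ suc (length w)
length-snoc e ε       = refl
length-snoc e (_ ∷ w) = cong suc (length-snoc e w)

infixl 5 _++_

_++_ : ∀ {G : Graph} {x y z} → Walk G x y → Walk G y z → Walk G x z
w ++ ε       = w
w ++ (e ∷ r) = snoc e w ++ r

length-++ : ∀ {G : Graph} {x y z} (w : Walk G x y) (r : Walk G y z) →
            length (w ++ r) ≡ length r + length w
length-++ w ε       = refl
length-++ w (e ∷ r) =
  trans (length-++ (snoc e w) r) (trans (cong (length r +_) (length-snoc e w)) (+-suc _ _))

depth : ∀ {G : Graph} {S} → V (Unfolding G S) → ℕ
depth = length ∘ proj₂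

Whole : (G : Graph) → V G → Set
Whole G v = IsWhole (Reach G v)

WholeSuccessors : Graph → Set
WholeSuccessors G = ∀ v → Whole G v → ∃ λ e → o G e ≡ v × Whole G (t G e)

root⇒whole : ∀ {G S} → IsRoot G S → Whole G S
root⇒whole {G} root = root , λ e → root (o G e) , root (t G e)

long-walk : ∀ {G} → WholeSuccessors G →
            ∀ j {v} → Whole G v → ∃₂ λ x (r : Walk G v x) → length r ≡ j × Whole G x
long-walk robust zero    whole = _ , ε , refl , whole
long-walk robust (suc j) whole with robust _ whole
... | e , refl , whole′ with long-walk robust j whole′
...   | x , r , refl , whole″ = x , e ∷ r , refl , whole″

depth-bound : ∀ {G S} (Sub : Subgraph (Unfolding G S)) → Finite (E (asGraph Sub)) →
              ∃ λ L → ∀ e → PE Sub e → length (proj₂ e) ≤ L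
depth-bound Sub finite =
  let L , bounded = uniform-bound finite (λ e L → length (proj₂ (value e)) ≤ L)
                                         (λ _ j≤k ≤j → ≤-trans ≤j j≤k) (λ _ → _ , ≤-refl)
  in  L , λ e p → bounded (e , [ p ])

module Deep {G : Graph} {S : V G} (Sub : Subgraph (Unfolding G S)) (L : ℕ)
            (bounded : ∀ e → PE Sub e → length (proj₂ e) ≤ L) where
  private
    U = Unfolding G S

  Deep : V U → Set
  Deep q = L < depth q

  deep-avoids : ∀ e → Deep (o U e) → ¬ PE Sub e
  deep-avoids e deep p = <⇒≱ deep (bounded e p)

  deep-closed : ∀ e → Deep (o U e) → Deep (t U e)
  deep-closed (e , w) deep = subst (L <_) (sym (length-snoc e w)) (≤-trans deep (n≤1+n _))

  deep-++ : ∀ {v x} (w : Walk G S v) (r : Walk G v x) → Deep (v , w) → Deep (x , w ++ r)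
  deep-++ w ε       deep = deep
  deep-++ w (e ∷ r) deep = deep-++ (snoc e w) r (deep-closed (e , w) deep)

  embed : (q : V U) → Deep q → V (U ∖ Sub)
  embed q deep = q , [ (λ { ((e , refl) , _ , all-out , _) → deep-avoids e deep (all-out e refl) }) ]

  bisimulation : Bisimulation (U ∖ Sub) U
  bisimulation = ∖-bisimulation U Sub Deep deep-avoids deep-closed

-- Almost isomorphic unfoldings

module Transfer {G H : Graph} {SG : V G} {SH : V H} (root : IsRoot G SG)
                (robust : WholeSuccessors G)
                (S₁ : Subgraph (Unfolding G SG)) (S₂ : Subgraph (Unfolding H SH))
                (finite₁ : Finite (E (asGraph S₁))) (finite₂ : Finite (E (asGraph S₂)))
                (φ : Iso (Unfolding G SG ∖ S₁) (Unfolding H SH ∖ S₂)) where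
  private
    T₁ = Unfolding G SG
    T₂ = Unfolding H SH
    L₁ = proj₁ (depth-bound S₁ finite₁)
    L₂ = proj₁ (depth-bound S₂ finite₂)
    module D₁ = Deep S₁ L₁ (proj₂ (depth-bound S₁ finite₁))
    module D₂ = Deep S₂ L₂ (proj₂ (depth-bound S₂ finite₂))
    open Iso φ

  bisimulation : Bisimulation G H
  bisimulation =
    bisimulation-∘ (bisimulation-sym (unfolding-bisimulation G SG))
      (bisimulation-∘ (bisimulation-sym D₁.bisimulation)
        (bisimulation-∘ (Iso⇒bisimulation φ)
          (bisimulation-∘ D₂.bisimulation (unfolding-bisimulation H SH))))

  Φ : (q : V T₁) → D₁.Deep q → V T₂
  Φ q deep = value (to isoV (D₁.embed q deep))

  related : (q : V T₁) (deep : D₁.Deep q) → D₂.Deep (Φ q deep) →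
            (bisimulation ∼ proj₁ q) (proj₁ (Φ q deep))
  related q deep deep′ = q , refl , D₁.embed q deep , (deep , refl) , _ , refl , _ , (deep′ , refl) , refl

  Φ-depth-snoc : ∀ e (deep : D₁.Deep (o T₁ e)) →
                 depth (Φ (t T₁ e) (D₁.deep-closed e deep)) ≡ suc (depth (Φ (o T₁ e) deep))
  Φ-depth-snoc e deep = begin
    depth (value (to isoV (t (T₁ ∖ S₁) ê)))       ≡⟨ cong (depth ∘ value) (t-compat ê) ⟨
    depth (value (t (T₂ ∖ S₂) (to isoE ê)))       ≡⟨ length-snoc _ _ ⟩
    suc (depth (value (o (T₂ ∖ S₂) (to isoE ê)))) ≡⟨ cong (suc ∘ depth ∘ value) (o-compat ê) ⟩
    suc (depth (value (to isoV (o (T₁ ∖ S₁) ê)))) ∎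
    where
    open ≡-Reasoning
    ê : E (T₁ ∖ S₁)
    ê = e , [ D₁.deep-avoids e deep ]

  Φ-depth-++ : ∀ {v x} (w : Walk G SG v) (r : Walk G v x) (deep : D₁.Deep (v , w)) →
               depth (Φ (x , w ++ r) (D₁.deep-++ w r deep)) ≡ length r + depth (Φ (v , w) deep)
  Φ-depth-++ w ε       deep = refl
  Φ-depth-++ w (e ∷ r) deep =
    trans (Φ-depth-++ (snoc e w) r (D₁.deep-closed (e , w) deep))
          (trans (cong (length r +_) (Φ-depth-snoc (e , w) deep)) (+-suc _ _))

  -- A walk of length L₁ + 1 from the root reaches a deep vertex; L₂ + 1 further steps, kept
  -- whole by robustness, push the depth of the image past L₂, and from there x is reachable.
  total : Total bisimulation
  total x with long-walk robust (suc L₁) (root⇒whole root)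
  ... | x₀ , r₀ , length-r₀ , whole₀ with long-walk robust (suc L₂) whole₀
  ...   | x₁ , r₁ , length-r₁ , (reach , _) = _ , related q deep deep′
    where
    open ≤-Reasoning
    r = reach x
    w₀ = ε ++ r₀
    w₁ = w₀ ++ r₁
    q = (x , w₁ ++ r)

    deep₀ : D₁.Deep (x₀ , w₀)
    deep₀ = begin
      suc L₁          ≡⟨ length-r₀ ⟨
      length r₀       ≤⟨ m≤m+n _ 0 ⟩
      length r₀ + 0   ≡⟨ length-++ ε r₀ ⟨
      length w₀       ∎

    deep₁ : D₁.Deep (x₁ , w₁)
    deep₁ = D₁.deep-++ w₀ r₁ deep₀

    deep : D₁.Deep q
    deep = D₁.deep-++ w₁ r deep₁

    deep′ : D₂.Deep (Φ q deep)
    deep′ = begin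
      suc L₂                                   ≡⟨ length-r₁ ⟨
      length r₁                                ≤⟨ m≤m+n _ _ ⟩
      length r₁ + depth (Φ (x₀ , w₀) deep₀)    ≡⟨ Φ-depth-++ w₀ r₁ deep₀ ⟨
      depth (Φ (x₁ , w₁) deep₁)                ≤⟨ m≤n+m _ (length r) ⟩
      length r + depth (Φ (x₁ , w₁) deep₁)     ≡⟨ Φ-depth-++ w₁ r deep₁ ⟨
      depth (Φ q deep)                         ∎

theorem7 : (G H : Graph) → FiniteGraph G → FiniteGraph H →
    NonRedundant G → NonRedundant H →
    RobustlyRooted G → RobustlyRooted H →
    (SG : V G) (SH : V H) → IsRoot G SG → IsRoot H SH →
    AlmostIsomorphic (Unfolding G SG) (Unfolding H SH) →
    Iso G H
theorem7 G H (finVG , _) (finVH , _) nrG nrH (_ , robustG) (_ , robustH) SG SH rootG rootH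
         (S₁ , S₂ , ((_ , finite₁) , _) , ((_ , finite₂) , _) , φ) =
  total-bisimulations⇒Iso finVG nrG finVH nrH GH.bisimulation GH.total HG.bisimulation HG.total
  where
  module GH = Transfer rootG robustG S₁ S₂ finite₁ finite₂ φ
  module HG = Transfer rootH robustH S₂ S₁ finite₂ finite₁ (Iso-sym φ)
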